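{- Let $\langle p_n:n\in\omega\rangle$ be a sequence of $0$-conditions and $\langle k_n:n\in\omega\rangle$ a strictly increasing sequence of elements of $\omega\setminus\{0\}$ such that $p_{n+1}\le_{k_n}p_n$ for all $n$. Define $q$ by: $s^q=s^{p_n}$ (for any $n$); $c^q_m=c^{p_0}_m$ for $m\in[0,k_0)$; and $c^q_m=c^{p_{n+1}}_m$ for $m\in[k_n,k_{n+1})$. Then $q$ is a $0$-condition and $q\le_{k_n}p_n$ for every $n\in\omega$.
   Context: A norm on $x\subseteq\omega$ is $\mathrm{nor}:[x]^{<\omega}\to\omega$ such that (1) $\mathrm{nor}(s)>0\Rightarrow|s|>1$; (2) $s\subseteq t\Rightarrow\mathrm{nor}(s)\le\mathrm{nor}(t)$; (3) if $n>0$, $\mathrm{nor}(s)\ge n$ and $s=s_0\cup s_1$ then $\mathrm{nor}(s_i)\ge n-1$ for some $i\in2$. A creature is $c=\langle s_c,\mathrm{nor}_c\rangle$ with $s_c$ a nonempty finite subset of $\omega$, $\mathrm{nor}_c$ a norm on $s_c$, $\mathrm{nor}_c(s_c)>0$; $c<d$ means $\max s_c<\min s_d$ and $\mathrm{nor}_c(s_c)<\mathrm{nor}_d(s_d)$. A $0$-condition is $p=\langle s^p,\langle c^p_n:n\in\omega\rangle\rangle$ with $s^p\in[\omega]^{<\omega}$, creatures $c^p_n<c^p_{n+1}$, and every element of $s^p$ below $\min s^p_0$ (writing $s^p_n,\mathrm{nor}^p_n$ for $s_{c^p_n},\mathrm{nor}_{c^p_n}$); $\mathrm{int}(p)=\bigcup_n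 s^p_n$. $q\le p$ means: (7) $s^q\supseteq s^p$, $s^q\setminus s^p\subseteq\mathrm{int}(p)$; (8) with $n_0$ least such that $s^p_m\cap s^q=\emptyset$ for all $m\ge n_0$, there is a strictly increasing $\langle i_n\rangle$ with $i_0=n_0$ and $s^q_n\subseteq\bigcup_{m\in[i_n,i_{n+1})}s^p_m$ for all $n$; (9) for all $n$ and $t\subseteq s^q_n$ with $\mathrm{nor}^q_n(t)>0$ there is $m$ with $\mathrm{nor}^p_m(t\cap s^p_m)>0$. $q\le_0p$ means $q\le p$ and $s^q=s^p$; for $n>0$, $q\le_np$ means $q\le_0p$ and $c^q_m=c^p_m$ for all $m\le n-1$. -}

module Defs where

open import Data.Nat using (ℕ; zero; suc; _≤_; _<_; _≥_; _∸_)
open import Data.Nat.Properties using (_≟_)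
open import Data.List using (List; filter)
open import Data.List.Membership.Propositional using (_∈_; _∉_)
open import Data.List.Membership.DecPropositional _≟_ using (_∈?_)
open import Data.List.Relation.Binary.Subset.Propositional using (_⊆_)
open import Data.Product using (Σ; ∃; ∃-syntax; _×_; _,_)
open import Data.Sum using (_⊎_)
open import Relation.Nullary using (¬_)
open import Relation.Binary.PropositionalEquality using (_≡_; _≢_)

-- Finite subsets of ω are represented by lists of naturals, read as the set
-- of their members; ⊆, ∈ are membership-based.

_≐_ : List ℕ → List ℕ → Set
s ≐ t = (s ⊆ t) × (t ⊆ s)

IsUnion : List ℕ → List ℕ → List ℕ → Set
IsUnion s s₀ s₁ = ∀ y → ((y ∈ s → (y ∈ s₀ ⊎ y ∈ s₁)) × ((y ∈ s₀ ⊎ y ∈ s₁) → y ∈ s))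

_∩_ : List ℕ → List ℕ → List ℕ
t ∩ s = filter (λ x → x ∈? s) t

Disjoint : List ℕ → List ℕ → Set
Disjoint s t = ∀ {x} → x ∈ s → x ∉ t

CardGt1 : List ℕ → Set
CardGt1 s = Σ ℕ λ a → Σ ℕ λ b → (a ∈ s) × (b ∈ s) × (a ≢ b)

-- all elements of s lie below all elements of t  (max s < min t for nonempty s, t)
_≪_ : List ℕ → List ℕ → Set
s ≪ t = ∀ {x y} → x ∈ s → y ∈ t → x < y

-- a norm on x : the function nor is only constrained on finite subsets of x
record IsNorm (x : List ℕ) (nor : List ℕ → ℕ) : Set where
  field
    norm1 : ∀ s → s ⊆ x → 0 < nor s → CardGt1 s
    norm2 : ∀ s t → s ⊆ x → t ⊆ x → s ⊆ t → nor s ≤ nor t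
    norm3 : ∀ n → 0 < n → ∀ s → s ⊆ x → n ≤ nor s →
            ∀ s₀ s₁ → IsUnion s s₀ s₁ →
            (n ∸ 1 ≤ nor s₀) ⊎ (n ∸ 1 ≤ nor s₁)

record PreCreature : Set where
  constructor ⟨_,_⟩
  field
    sc  : List ℕ
    nor : List ℕ → ℕ
open PreCreature public

record IsCreature (c : PreCreature) : Set where
  field
    nonempty : ∃[ a ] (a ∈ sc c)
    isNorm   : IsNorm (sc c) (nor c)
    normPos  : 0 < nor c (sc c)

_<ᶜ_ : PreCreature → PreCreature → Set
c <ᶜ d = (sc c ≪ sc d) × (nor c (sc c) < nor d (sc d))

_≈ᶜ_ : PreCreature → PreCreature → Set
c ≈ᶜ d = (sc c ≐ sc d) × (∀ t → t ⊆ sc c → nor c t ≡ nor d t)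

record PreCond : Set where
  constructor ⟪_,_⟫
  field
    stem : List ℕ
    cr   : ℕ → PreCreature
open PreCond public

record IsZeroCond (p : PreCond) : Set where
  field
    creatures  : ∀ n → IsCreature (cr p n)
    increasing : ∀ n → cr p n <ᶜ cr p (suc n)
    stemBelow  : stem p ≪ sc (cr p 0)

_∈int_ : ℕ → PreCond → Set
x ∈int p = ∃[ m ] (x ∈ sc (cr p m))

record _≤ᶜ_ (q p : PreCond) : Set where
  field
    cond7a : stem p ⊆ stem q
    cond7b : ∀ {x} → x ∈ stem q → x ∉ stem p → x ∈int p
    cond8  : Σ ℕ λ n₀ →
               (∀ m → n₀ ≤ m → Disjoint (sc (cr p m)) (stem q))
             × (∀ n′ → (∀ m → n′ ≤ m → Disjoint (sc (cr p m)) (stem q)) → n₀ ≤ n′)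
             × Σ (ℕ → ℕ) λ i →
                 (∀ n → i n < i (suc n))
               × (i 0 ≡ n₀)
               × (∀ n {x} → x ∈ sc (cr q n) →
                    ∃[ m ] (i n ≤ m × m < i (suc n) × x ∈ sc (cr p m)))
    cond9  : ∀ n t → t ⊆ sc (cr q n) → 0 < nor (cr q n) t →
             ∃[ m ] (0 < nor (cr p m) (t ∩ sc (cr p m)))

-- q ≤_n p  (for n = 0 this is ≤_0; the creature clause is then vacuous)
_≤[_]_ : PreCond → ℕ → PreCond → Set
q ≤[ n ] p = (q ≤ᶜ p) × (stem q ≐ stem p) × (∀ m → m < n → cr q m ≈ᶜ cr p m)

module Submission where

-- The creature-part of q ≤ p (clauses (8) and (9)) is a pointwise property
-- of the creatures of q: each creature c of q lies in a block of creatures of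
-- p ('LiesIn') and every positive-norm subset of c keeps positive norm inside
-- some creature of p ('ReflectsNorm').  Both notions compose, so along the
-- chain p_{j+d} ≤ … ≤ p_j every creature of p_{j+d} lies in (and reflects
-- norms into) p_j, with block boundaries given by the composite F_j d of the
-- d block maps.  The fusion q agrees with p_N on all creatures below k_N up to
-- creature equivalence ≈ᶜ; as n < k_{n+j}, the n-th creature of q is
-- equivalent to that of p_{n+j}, which gives clauses (8), (9) for q ≤ p_j with
-- the diagonal block map n ↦ F_j n n.  Being a creature and the order <ᶜ are
-- invariant under ≈ᶜ, which makes q a 0-condition.  The stems are all equal and
-- lie below every creature, so clause (7) is immediate and n₀ = 0 in (8).

open import Defs
open import Data.Nat using (ℕ; zero; suc; _≤_; _<_; _+_; _∸_; z≤n; _≤′_; ≤′-refl; ≤′-step)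
open import Data.Nat.Properties
  using (≤-refl; ≤-trans; ≤-antisym; <-trans; ≤-<-trans; <-≤-trans; <⇒≤; n<1+n;
         m≤m+n; <-irrefl; _<?_; ≮⇒≥; ≤⇒≤′; _≟_)
open import Data.Product using (_×_; _,_; proj₁; proj₂; ∃-syntax)
open import Data.Sum using (inj₁; inj₂)
import Data.Sum as Sum
open import Data.Empty using (⊥-elim)
open import Data.List.Relation.Binary.Subset.Propositional using (_⊆_)
open import Data.List.Membership.Propositional using (_∈_)
open import Data.List.Membership.DecPropositional _≟_ using (_∈?_)
open import Data.List.Membership.Propositional.Properties using (∈-filter⁺; ∈-filter⁻)
open import Relation.Nullary using (yes; no)
open import Relation.Binary.PropositionalEquality using (_≡_; refl; sym; trans; subst; subst₂)

≈ᶜ-reflexive : ∀ {c d} → c ≡ d → c ≈ᶜ d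
≈ᶜ-reflexive refl = ((λ x∈ → x∈) , (λ x∈ → x∈)) , (λ _ _ → refl)

≈ᶜ-sym : ∀ {c d} → c ≈ᶜ d → d ≈ᶜ c
≈ᶜ-sym ((c⊆d , d⊆c) , same) = (d⊆c , c⊆d) , (λ t t⊆ → sym (same t (λ x∈ → d⊆c (t⊆ x∈))))

≈ᶜ-trans : ∀ {c d e} → c ≈ᶜ d → d ≈ᶜ e → c ≈ᶜ e
≈ᶜ-trans ((c⊆d , d⊆c) , same₁) ((d⊆e , e⊆d) , same₂) =
  ((λ x∈ → d⊆e (c⊆d x∈)) , (λ x∈ → d⊆c (e⊆d x∈))) ,
  (λ t t⊆ → trans (same₁ t t⊆) (same₂ t (λ x∈ → c⊆d (t⊆ x∈))))

-- Equivalent creatures have the same norm on their whole (equal) domains;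
-- this uses monotonicity of the norm, since the domains are only equal as sets.
≈ᶜ-fullNorm : ∀ {c d} → IsNorm (sc d) (nor d) → c ≈ᶜ d → nor c (sc c) ≡ nor d (sc d)
≈ᶜ-fullNorm {c} {d} N ((c⊆d , d⊆c) , same) = trans (same (sc c) (λ x∈ → x∈))
  (≤-antisym (IsNorm.norm2 N (sc c) (sc d) c⊆d (λ x∈ → x∈) c⊆d)
             (IsNorm.norm2 N (sc d) (sc c) (λ x∈ → x∈) c⊆d d⊆c))

-- The norm axioms only look at subsets of the domain, so they transfer along ≈ᶜ.
isNorm-≈ᶜ : ∀ {c d} → c ≈ᶜ d → IsNorm (sc d) (nor d) → IsNorm (sc c) (nor c)
isNorm-≈ᶜ {c} {d} ((c⊆d , _) , same) N = record
  { norm1 = λ s s⊆ pos → IsNorm.norm1 N s (into s⊆) (subst (0 <_) (same s s⊆) pos)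
  ; norm2 = λ s t s⊆ t⊆ s⊆t → subst₂ _≤_ (sym (same s s⊆)) (sym (same t t⊆))
               (IsNorm.norm2 N s t (into s⊆) (into t⊆) s⊆t)
  ; norm3 = λ n pos s s⊆ n≤ s₀ s₁ u →
      let s₀⊆ = λ {y} (y∈ : y ∈ s₀) → s⊆ (proj₂ (u y) (inj₁ y∈))
          s₁⊆ = λ {y} (y∈ : y ∈ s₁) → s⊆ (proj₂ (u y) (inj₂ y∈))
      in Sum.map (subst (n ∸ 1 ≤_) (sym (same s₀ s₀⊆)))
                 (subst (n ∸ 1 ≤_) (sym (same s₁ s₁⊆)))
                 (IsNorm.norm3 N n pos s (into s⊆) (subst (n ≤_) (same s s⊆) n≤) s₀ s₁ u)
  }
  where
    into : ∀ {s} → s ⊆ sc c → s ⊆ sc d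
    into s⊆ x∈ = c⊆d (s⊆ x∈)

isCreature-≈ᶜ : ∀ {c d} → c ≈ᶜ d → IsCreature d → IsCreature c
isCreature-≈ᶜ c≈d@((_ , d⊆c) , _) C = record
  { nonempty = let (x , x∈) = IsCreature.nonempty C in x , d⊆c x∈
  ; isNorm   = isNorm-≈ᶜ c≈d N
  ; normPos  = subst (0 <_) (sym (≈ᶜ-fullNorm N c≈d)) (IsCreature.normPos C)
  }
  where N = IsCreature.isNorm C

<ᶜ-≈ᶜ : ∀ {c c′ d d′} → c ≈ᶜ c′ → d ≈ᶜ d′ →
        IsNorm (sc c′) (nor c′) → IsNorm (sc d′) (nor d′) → c′ <ᶜ d′ → c <ᶜ d
<ᶜ-≈ᶜ c≈ d≈ Nc Nd (below , smaller) =
  (λ x∈ y∈ → below (proj₁ (proj₁ c≈) x∈) (proj₁ (proj₁ d≈) y∈)) ,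
  subst₂ _<_ (sym (≈ᶜ-fullNorm Nc c≈)) (sym (≈ᶜ-fullNorm Nd d≈)) smaller

StrictlyIncreasing : (ℕ → ℕ) → Set
StrictlyIncreasing f = ∀ n → f n < f (suc n)

module _ {f : ℕ → ℕ} (inc : StrictlyIncreasing f) where

  si-mono : ∀ {a b} → a ≤ b → f a ≤ f b
  si-mono a≤b = go (≤⇒≤′ a≤b)
    where
      go : ∀ {a b} → a ≤′ b → f a ≤ f b
      go ≤′-refl      = ≤-refl
      go (≤′-step a≤) = ≤-trans (go a≤) (<⇒≤ (inc _))

  si-strict : ∀ {a b} → a < b → f a < f b
  si-strict {a} a<b = <-≤-trans (inc a) (si-mono a<b)

  si-inflationary : ∀ n → n ≤ f n
  si-inflationary zero    = z≤n
  si-inflationary (suc n) = ≤-<-trans (si-inflationary n) (inc n)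

  si-above : 0 < f 0 → ∀ n → n < f n
  si-above pos zero    = pos
  si-above pos (suc n) = ≤-<-trans (si-above pos n) (inc n)

∩-⊆ˡ : ∀ {t s x} → x ∈ t ∩ s → x ∈ t
∩-⊆ˡ {t} {s} x∈ = proj₁ (∈-filter⁻ (λ x → x ∈? s) {xs = t} x∈)

∩-⊆ʳ : ∀ {t s x} → x ∈ t ∩ s → x ∈ s
∩-⊆ʳ {t} {s} x∈ = proj₂ (∈-filter⁻ (λ x → x ∈? s) {xs = t} x∈)

∩-intro : ∀ {t s x} → x ∈ t → x ∈ s → x ∈ t ∩ s
∩-intro {t} {s} x∈t x∈s = ∈-filter⁺ (λ x → x ∈? s) {xs = t} x∈t x∈s

module _ {p : PreCond} (zp : IsZeroCond p) where

  creatureNorm : ∀ m → IsNorm (sc (cr p m)) (nor (cr p m))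
  creatureNorm m = IsCreature.isNorm (IsZeroCond.creatures zp m)

  stemBelowAll : ∀ m → stem p ≪ sc (cr p m)
  stemBelowAll zero = IsZeroCond.stemBelow zp
  stemBelowAll (suc m) x∈ y∈ =
    let (z , z∈) = IsCreature.nonempty (IsZeroCond.creatures zp m)
    in <-trans (stemBelowAll m x∈ z∈) (proj₁ (IsZeroCond.increasing zp m) z∈ y∈)

LiesIn : PreCreature → PreCond → ℕ → ℕ → Set
LiesIn c p a b = ∀ {x} → x ∈ sc c → ∃[ m ] (a ≤ m × m < b × x ∈ sc (cr p m))

ReflectsNorm : PreCreature → PreCond → Set
ReflectsNorm c p = ∀ t → t ⊆ sc c → 0 < nor c t → ∃[ m ] (0 < nor (cr p m) (t ∩ sc (cr p m)))

liesIn-refl : ∀ p m → LiesIn (cr p m) p m (suc m)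
liesIn-refl p m x∈ = m , ≤-refl , n<1+n m , x∈

liesIn-trans : ∀ {c q p a b} {i : ℕ → ℕ} → StrictlyIncreasing i →
               LiesIn c q a b → (∀ m → LiesIn (cr q m) p (i m) (i (suc m))) →
               LiesIn c p (i a) (i b)
liesIn-trans inc c⊑q q⊑p x∈ with c⊑q x∈
... | m , a≤m , m<b , x∈m with q⊑p m x∈m
... | m′ , im≤m′ , m′<ism , x∈m′ =
  m′ , ≤-trans (si-mono inc a≤m) im≤m′ , <-≤-trans m′<ism (si-mono inc m<b) , x∈m′

liesIn-≈ᶜ : ∀ {c d p a b} → c ≈ᶜ d → LiesIn d p a b → LiesIn c p a b
liesIn-≈ᶜ ((c⊆d , _) , _) d⊑p x∈ = d⊑p (c⊆d x∈)

liesIn-widen : ∀ {c p a b b′} → b ≤ b′ → LiesIn c p a b → LiesIn c p a b′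
liesIn-widen b≤b′ c⊑p x∈ with c⊑p x∈
... | m , a≤m , m<b , x∈m = m , a≤m , <-≤-trans m<b b≤b′ , x∈m

-- norms of creatures of p are reflected by p itself, as t ⊆ t ∩ sc (cr p m)
reflectsNorm-refl : ∀ {p} → IsZeroCond p → ∀ m → ReflectsNorm (cr p m) p
reflectsNorm-refl {p} zp m t t⊆ pos = m , <-≤-trans pos
  (IsNorm.norm2 (creatureNorm zp m) t (t ∩ sc (cr p m)) t⊆ (∩-⊆ʳ {t})
     (λ x∈ → ∩-intro {t} x∈ (t⊆ x∈)))

-- A positive subset t of c is positive on t ∩ d for a creature d of q, and
-- t ∩ d is positive on t ∩ d ∩ e for a creature e of p; by monotonicity of
-- the norm of e, already t ∩ e is positive.
reflectsNorm-trans : ∀ {c q p} → IsZeroCond p →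
                     ReflectsNorm c q → (∀ m → ReflectsNorm (cr q m) p) → ReflectsNorm c p
reflectsNorm-trans {c} {q} {p} zp c⊑q q⊑p t t⊆ pos with c⊑q t t⊆ pos
... | m , posm with q⊑p m (t ∩ sc (cr q m)) (∩-⊆ʳ {t}) posm
... | m′ , posm′ = m′ , <-≤-trans posm′
  (IsNorm.norm2 (creatureNorm zp m′) (tq ∩ E) (t ∩ E) (∩-⊆ʳ {tq}) (∩-⊆ʳ {t})
     (λ x∈ → ∩-intro {t} (∩-⊆ˡ {t} (∩-⊆ˡ {tq} x∈)) (∩-⊆ʳ {tq} x∈)))
  where
    tq = t ∩ sc (cr q m)
    E  = sc (cr p m′)

reflectsNorm-≈ᶜ : ∀ {c d p} → c ≈ᶜ d → ReflectsNorm d p → ReflectsNorm c p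
reflectsNorm-≈ᶜ ((c⊆d , _) , same) d⊑p t t⊆ pos =
  d⊑p t (λ x∈ → c⊆d (t⊆ x∈)) (subst (0 <_) (same t t⊆) pos)

blockMap : ∀ {q p} → q ≤ᶜ p → ℕ → ℕ
blockMap q≤p = proj₁ (proj₂ (proj₂ (proj₂ (_≤ᶜ_.cond8 q≤p))))

blockMap-increasing : ∀ {q p} (q≤p : q ≤ᶜ p) → StrictlyIncreasing (blockMap q≤p)
blockMap-increasing q≤p = proj₁ (proj₂ (proj₂ (proj₂ (proj₂ (_≤ᶜ_.cond8 q≤p)))))

blockMap-liesIn : ∀ {q p} (q≤p : q ≤ᶜ p) →
                  ∀ n → LiesIn (cr q n) p (blockMap q≤p n) (blockMap q≤p (suc n))
blockMap-liesIn q≤p = proj₂ (proj₂ (proj₂ (proj₂ (proj₂ (proj₂ (_≤ᶜ_.cond8 q≤p))))))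

module Chain (p : ℕ → PreCond) (zp : ∀ n → IsZeroCond (p n))
             (step : ∀ n → p (suc n) ≤ᶜ p n) (j : ℕ) where

  -- F d m : index in p_j of the first creature covering creature m of p_{d+j}
  F : ℕ → ℕ → ℕ
  F zero    m = m
  F (suc d) m = F d (blockMap (step (d + j)) m)

  F-increasing : ∀ d → StrictlyIncreasing (F d)
  F-increasing zero    = n<1+n
  F-increasing (suc d) n = si-strict (F-increasing d) (blockMap-increasing (step (d + j)) n)

  chain-liesIn : ∀ d m → LiesIn (cr (p (d + j)) m) (p j) (F d m) (F d (suc m))
  chain-liesIn zero    m = liesIn-refl (p j) m
  chain-liesIn (suc d) m =
    liesIn-trans {c = cr (p (suc d + j)) m} {q = p (d + j)} {p = p j}
      (F-increasing d) (blockMap-liesIn (step (d + j)) m) (chain-liesIn d)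

  chain-reflectsNorm : ∀ d m → ReflectsNorm (cr (p (d + j)) m) (p j)
  chain-reflectsNorm zero    m = reflectsNorm-refl (zp j) m
  chain-reflectsNorm (suc d) m =
    reflectsNorm-trans {q = p (d + j)} (zp j)
      (_≤ᶜ_.cond9 (step (d + j)) m) (chain-reflectsNorm d)

  I : ℕ → ℕ
  I n = F n n

  F-below-I : ∀ n → F n (suc n) ≤ I (suc n)
  F-below-I n = si-mono (F-increasing n)
    (si-inflationary (blockMap-increasing (step (n + j))) (suc n))

  I-increasing : StrictlyIncreasing I
  I-increasing n = <-≤-trans (F-increasing n n) (F-below-I n)

  diagonal-liesIn : ∀ n → LiesIn (cr (p (n + j)) n) (p j) (I n) (I (suc n))
  diagonal-liesIn n =
    liesIn-widen {c = cr (p (n + j)) n} {p = p j} (F-below-I n) (chain-liesIn n n)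

module Fusion (p : ℕ → PreCond) (k : ℕ → ℕ)
    (zp : ∀ n → IsZeroCond (p n))
    (kpos : ∀ n → 0 < k n)
    (kinc : StrictlyIncreasing k)
    (step : ∀ n → p (suc n) ≤[ k n ] p n)
    (q : PreCond)
    (stem≡ : stem q ≡ stem (p 0))
    (first : ∀ m → m < k 0 → cr q m ≡ cr (p 0) m)
    (later : ∀ n m → k n ≤ m → m < k (suc n) → cr q m ≡ cr (p (suc n)) m) where

  -- q agrees with p_N below k_N: below k_{N-1} by induction, since p_N and
  -- p_{N-1} agree there, and on [k_{N-1}, k_N) by definition of q.
  agrees : ∀ N m → m < k N → cr q m ≈ᶜ cr (p N) m
  agrees zero    m m<k = ≈ᶜ-reflexive (first m m<k)
  agrees (suc N) m m<k with m <? k N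
  ... | yes m<k′ = ≈ᶜ-trans (agrees N m m<k′) (≈ᶜ-sym (proj₂ (proj₂ (step N)) m m<k′))
  ... | no  m≮k′ = ≈ᶜ-reflexive (later N m (≮⇒≥ m≮k′) m<k)

  k-above : ∀ n → n < k n
  k-above = si-above kinc (kpos 0)

  diagonal : ∀ j n → cr q n ≈ᶜ cr (p (n + j)) n
  diagonal j n = agrees (n + j) n (≤-<-trans (m≤m+n n j) (k-above (n + j)))

  -- creature n of q is equivalent to creature n of p_n, and creatures n, n+1
  -- of q to those of p_{n+1}; being a creature and <ᶜ transfer along ≈ᶜ
  isZeroCond : IsZeroCond q
  isZeroCond = record
    { creatures  = λ n → isCreature-≈ᶜ (agrees n n (k-above n)) (IsZeroCond.creatures (zp n) n)
    ; increasing = λ n → <ᶜ-≈ᶜ (agrees (suc n) n (<-trans (n<1+n n) (k-above (suc n))))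
                                (agrees (suc n) (suc n) (k-above (suc n)))
                                (creatureNorm (zp (suc n)) n) (creatureNorm (zp (suc n)) (suc n))
                                (IsZeroCond.increasing (zp (suc n)) n)
    ; stemBelow  = subst₂ (λ s c → s ≪ sc c) (sym stem≡) (sym (first 0 (kpos 0)))
                     (IsZeroCond.stemBelow (zp 0))
    }

  sameStem : ∀ j → stem q ≐ stem (p j)
  sameStem zero = subst (_≐ stem (p 0)) (sym stem≡) ((λ x∈ → x∈) , (λ x∈ → x∈))
  sameStem (suc j) with sameStem j | proj₁ (proj₂ (step j))
  ... | (q⊆ , ⊆q) | (s⊆ , ⊆s) = (λ x∈ → ⊆s (q⊆ x∈)) , (λ x∈ → ⊆q (s⊆ x∈))

  -- the stem of q is below every creature of p_j, hence n₀ = 0 in clause (8)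
  below : ∀ j → q ≤ᶜ p j
  below j = record
    { cond7a = proj₂ (sameStem j)
    ; cond7b = λ x∈ x∉ → ⊥-elim (x∉ (proj₁ (sameStem j) x∈))
    ; cond8  = 0 , stemDisjoint , (λ _ _ → z≤n) , C.I , C.I-increasing , refl ,
               (λ n → liesIn-≈ᶜ {p = p j} (diagonal j n) (C.diagonal-liesIn n))
    ; cond9  = λ n → reflectsNorm-≈ᶜ {p = p j} (diagonal j n) (C.chain-reflectsNorm n n)
    }
    where
      module C = Chain p zp (λ n → proj₁ (step n)) j
      stemDisjoint : ∀ m → 0 ≤ m → Disjoint (sc (cr (p j) m)) (stem q)
      stemDisjoint m _ x∈m x∈s =
        <-irrefl refl (stemBelowAll (zp j) m (proj₁ (sameStem j) x∈s) x∈m)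

  belowₖ : ∀ j → q ≤[ k j ] p j
  belowₖ j = below j , sameStem j , agrees j

lemma2p2 : (p : ℕ → PreCond) (k : ℕ → ℕ) →
           (∀ n → IsZeroCond (p n)) →
           (∀ n → 0 < k n) →
           (∀ n → k n < k (suc n)) →
           (∀ n → p (suc n) ≤[ k n ] p n) →
           (q : PreCond) →
           stem q ≡ stem (p 0) →
           (∀ m → m < k 0 → cr q m ≡ cr (p 0) m) →
           (∀ n m → k n ≤ m → m < k (suc n) → cr q m ≡ cr (p (suc n)) m) →
           IsZeroCond q × (∀ n → q ≤[ k n ] p n)
lemma2p2 p k zp kpos kinc step q stem≡ first later =
  isZeroCond , belowₖ
  where open Fusion p k zp kpos kinc step q stem≡ first later
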